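{- Let $k,n$ be positive integers and let $T$ be a treedepth decomposition of the grid $P_{2^k-1} \times P_n$ with vertex set $\{(i,j) \mid 1\le i\le n,\ 1\le j\le 2^k-1\}$. Suppose there is a positive integer $d$ such that for every $1 \le j \le 2^k-1$ there exists some $i$ with $(i,j) \in top(T,d)$. Then $d \ge k$.
   Context: $P_a \times P_n$ denotes the grid graph with vertex set $\{(i,j) \mid 1\le i\le n,\ 1\le j\le a\}$, where $(i,j)$ and $(i',j')$ are adjacent iff $|i-i'|+|j-j'|=1$. A treedepth decomposition of a graph $G$ is a rooted forest $T$ with $V(T)=V(G)$ such that for every edge $uv$ of $G$, one of $u,v$ is an ancestor of the other in $T$. The depth of a root is $1$, and $top(T,d) := \{v \in V(T) \mid \text{depth of } v \text{ in } T \le d\}$. -}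

module Defs where

open import Data.Nat using (ℕ; suc; _+_; ∣_-_∣)
open import Data.Fin using (Fin; toℕ)
open import Data.Maybe using (Maybe; just; nothing)
open import Data.Product using (_×_; _,_)
open import Data.Sum using (_⊎_)
open import Relation.Binary.PropositionalEquality using (_≡_)

-- Grid P_a × P_n : vertices (i , j) with i : Fin n (row index 1..n, shifted to 0..n-1)
-- and j : Fin a (column index 1..a, shifted to 0..a-1).
GridV : ℕ → ℕ → Set
GridV a n = Fin n × Fin a

GridAdj : (a n : ℕ) → GridV a n → GridV a n → Set
GridAdj a n (i , j) (i' , j') = ∣ toℕ i - toℕ i' ∣ + ∣ toℕ j - toℕ j' ∣ ≡ 1

-- A rooted forest on V given by a parent map (nothing = root).
-- Anc parent u v : u is a (proper) ancestor of v.
data Anc {V : Set} (parent : V → Maybe V) : V → V → Set where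
  par  : ∀ {u v} → parent v ≡ just u → Anc parent u v
  step : ∀ {u w v} → parent v ≡ just w → Anc parent u w → Anc parent u v

-- Treedepth decomposition of the graph (V, E): a rooted forest on V (parent map),
-- together with its depth function (roots have depth 1, a child has depth one more
-- than its parent; this forces acyclicity and determines depth uniquely), such that
-- for every edge uv one endpoint is an ancestor of the other.
record TreedepthDecomposition {V : Set} (E : V → V → Set) : Set where
  field
    parent      : V → Maybe V
    depth       : V → ℕ
    root-depth  : ∀ v → parent v ≡ nothing → depth v ≡ 1
    child-depth : ∀ v u → parent v ≡ just u → depth v ≡ suc (depth u)
    edge-anc    : ∀ u v → E u v → Anc parent u v ⊎ Anc parent v u

{-# OPTIONS --safe #-}
module Submission where

-- Consider a band of consecutive columns of width at least 2^k − 1 all of whose vertices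
-- have depth greater than m. The band is connected and every edge joins comparable vertices,
-- so a vertex u of least depth in the band is an ancestor of every other vertex of the band.
-- One of the two parts of the band left of and right of u's column has width at least
-- 2^(k−1) − 1, and all its vertices are deeper than u, which is deeper than m. Induction on k
-- ends in a single column, which by hypothesis contains a vertex of depth at most d; so k + m ≤ d.

open import Defs
open import Data.Nat
  using (ℕ; zero; suc; _+_; _*_; _≤_; _<_; _^_; _∸_; z≤n; z<s; s≤s; s≤s⁻¹; ∣_-_∣; _≤?_; _<?_; _≟_)
open import Data.Nat.Properties
open import Data.Nat.Induction using (<-wellFounded)
open import Data.Fin using (Fin; toℕ; fromℕ<)
open import Data.Fin.Properties using (toℕ-fromℕ<; toℕ<n; toℕ-injective; any?)
open import Data.Product using (∃; _,_; _×_; proj₂)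
open import Data.Sum using (_⊎_; inj₁; inj₂)
open import Data.Maybe using (Maybe; just; nothing)
open import Data.Maybe.Properties using (just-injective)
open import Data.Empty using (⊥-elim)
open import Function using (_∘_; _⇔_; mk⇔; Equivalence)
import Function.Properties.Equivalence as ⇔
open import Induction.WellFounded using (Acc; acc)
open import Relation.Nullary using (yes; no; ¬_)
open import Relation.Nullary.Decidable using (_×-dec_)
open import Relation.Unary using (Decidable)
open import Relation.Binary.PropositionalEquality

least-witness : {P : ℕ → Set} → Decidable P → ∀ {n} → P n →
                ∃ λ m → P m × (∀ {k} → k < m → ¬ P k)
least-witness {P} P? {n} = search (<-wellFounded n)
  where
  search : ∀ {n} → Acc _<_ n → P n → ∃ λ m → P m × (∀ {k} → k < m → ¬ P k)
  search {n} (acc smaller) pn with anyUpTo? P? n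
  ... | yes (k , k<n , pk) = search (smaller k<n) pk
  ... | no none            = n , pn , λ k<n pk → none (_ , k<n , pk)

∣n-1+n∣≡1 : ∀ x → ∣ x - suc x ∣ ≡ 1
∣n-1+n∣≡1 x = trans (cong (∣ x -_∣) (+-comm 1 x)) (∣m-m+n∣≡n x 1)

column-split : ∀ {lo hi c} p → lo + 2 * p ≤ suc hi → lo + p ≤ suc c ⊎ suc c + p ≤ suc hi
column-split {lo} {hi} {c} p size with lo + p ≤? suc c
... | yes left = inj₁ left
... | no ¬left = inj₂ (begin
  suc c + p         ≤⟨ n≤1+n _ ⟩
  suc (suc c) + p   ≤⟨ +-monoˡ-≤ p (≰⇒> ¬left) ⟩
  lo + p + p        ≡⟨ +-assoc lo p p ⟩
  lo + (p + p)      ≡⟨ cong (λ q → lo + (p + q)) (sym (+-identityʳ p)) ⟩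
  lo + 2 * p        ≤⟨ size ⟩
  suc hi            ∎)
  where open ≤-Reasoning

columns-nonempty : ∀ k {lo hi} → lo + 2 ^ suc k ≤ suc hi → lo < hi
columns-nonempty k {lo} {hi} size = s≤s⁻¹ (begin
  2 + lo        ≡⟨ +-comm 2 lo ⟩
  lo + 2        ≤⟨ +-monoʳ-≤ lo (^-monoʳ-≤ 2 (s≤s (z≤n {k}))) ⟩
  lo + 2 ^ suc k ≤⟨ size ⟩
  suc hi        ∎)
  where open ≤-Reasoning

interval-connected : (Q : ℕ → Set) {lo hi : ℕ} →
                     (∀ {y} → lo ≤ y → suc y < hi → Q y ⇔ Q (suc y)) →
                     ∀ {x} → lo ≤ x → x < hi → Q lo ⇔ Q x
interval-connected Q next {zero} z≤n _ = ⇔.refl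
interval-connected Q {lo} next {suc x} lo≤1+x x<hi with m≤n⇒m<n∨m≡n lo≤1+x
... | inj₁ lo<1+x =
  ⇔.trans (interval-connected Q next lo≤x (<-trans (n<1+n x) x<hi)) (next lo≤x x<hi)
  where
  lo≤x : lo ≤ x
  lo≤x = s≤s⁻¹ lo<1+x
... | inj₂ refl   = ⇔.refl

Fin-interval-connected : ∀ {m} (P : Fin m → Set) {lo hi : ℕ} → hi ≤ m →
  (∀ {j j′} → lo ≤ toℕ j → toℕ j′ < hi → toℕ j′ ≡ suc (toℕ j) → P j ⇔ P j′) →
  ∀ {c j} → lo ≤ toℕ c → toℕ c < hi → lo ≤ toℕ j → toℕ j < hi → P c → P j
Fin-interval-connected {m} P {lo} {hi} hi≤m next lo≤c c<hi lo≤j j<hi =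
  Equivalence.to (⇔.trans (⇔.sym (from-lo lo≤c c<hi)) (from-lo lo≤j j<hi))
  where
  Q : ℕ → Set
  Q x = ∀ j → toℕ j ≡ x → P j

  at : ∀ {j x} → toℕ j ≡ x → Q x ⇔ P j
  at {j} refl = mk⇔ (λ q → q j refl) λ pj j′ eq → subst P (toℕ-injective (sym eq)) pj

  Q-step : ∀ {x} → lo ≤ x → suc x < hi → Q x ⇔ Q (suc x)
  Q-step {x} lo≤x 1+x<hi =
    ⇔.trans (at j₀-at) (⇔.trans (next (subst (lo ≤_) (sym j₀-at) lo≤x)
                                      (subst (_< hi) (sym j₁-at) 1+x<hi)
                                      (trans j₁-at (cong suc (sym j₀-at))))
                                (⇔.sym (at j₁-at)))
    where
    x<m : x < m
    x<m = <-≤-trans (<-trans (n<1+n x) 1+x<hi) hi≤m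
    1+x<m : suc x < m
    1+x<m = <-≤-trans 1+x<hi hi≤m
    j₀-at : toℕ (fromℕ< x<m) ≡ x
    j₀-at = toℕ-fromℕ< x<m
    j₁-at : toℕ (fromℕ< 1+x<m) ≡ suc x
    j₁-at = toℕ-fromℕ< 1+x<m

  from-lo : ∀ {j} → lo ≤ toℕ j → toℕ j < hi → Q lo ⇔ P j
  from-lo lo≤j j<hi = ⇔.trans (interval-connected Q Q-step lo≤j j<hi) (at refl)

module _ {V : Set} {parent : V → Maybe V} where

  Anc-trans : ∀ {x y z} → Anc parent x y → Anc parent y z → Anc parent x z
  Anc-trans x<y (par p)      = step p x<y
  Anc-trans x<y (step p y<z) = step p (Anc-trans x<y y<z)

  Anc-common-descendant : ∀ {x y z} → Anc parent x z → Anc parent y z →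
                          x ≡ y ⊎ Anc parent x y ⊎ Anc parent y x
  Anc-common-descendant (par p) (par q) = inj₁ (just-injective (trans (sym p) q))
  Anc-common-descendant (par p) (step q y<w) with just-injective (trans (sym p) q)
  ... | refl = inj₂ (inj₂ y<w)
  Anc-common-descendant (step p x<w) (par q) with just-injective (trans (sym p) q)
  ... | refl = inj₂ (inj₁ x<w)
  Anc-common-descendant (step p x<w) (step q y<w) with just-injective (trans (sym p) q)
  ... | refl = Anc-common-descendant x<w y<w

module Decomposition {V : Set} {E : V → V → Set} (T : TreedepthDecomposition E) where
  open TreedepthDecomposition T public

  _⊑_ : V → V → Set
  u ⊑ x = u ≡ x ⊎ Anc parent u x

  depth-positive : ∀ v → 0 < depth v
  depth-positive v with parent v in eq
  ... | nothing = subst (0 <_) (sym (root-depth v eq)) z<s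
  ... | just u  = subst (0 <_) (sym (child-depth v u eq)) z<s

  Anc⇒depth< : ∀ {u v} → Anc parent u v → depth u < depth v
  Anc⇒depth< (par {u} {v} p) = ≤-reflexive (sym (child-depth v u p))
  Anc⇒depth< (step {u} {w} {v} p u<w) =
    <-trans (Anc⇒depth< u<w) (≤-reflexive (sym (child-depth v w p)))

  ⊑-extend : ∀ {u x y} → Anc parent x y ⊎ Anc parent y x → depth u ≤ depth y → u ⊑ x → u ⊑ y
  ⊑-extend (inj₁ x<y) _ (inj₁ refl) = inj₂ x<y
  ⊑-extend (inj₁ x<y) _ (inj₂ u<x)  = inj₂ (Anc-trans u<x x<y)
  ⊑-extend (inj₂ y<x) du≤dy (inj₁ refl) = ⊥-elim (<⇒≱ (Anc⇒depth< y<x) du≤dy)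
  ⊑-extend (inj₂ y<x) du≤dy (inj₂ u<x) with Anc-common-descendant u<x y<x
  ... | inj₁ u≡y        = inj₁ u≡y
  ... | inj₂ (inj₁ u<y) = inj₂ u<y
  ... | inj₂ (inj₂ y<u) = ⊥-elim (<⇒≱ (Anc⇒depth< y<u) du≤dy)

module _ {a n : ℕ} where

  GridAdj-sym : ∀ x y → GridAdj a n x y → GridAdj a n y x
  GridAdj-sym (i , j) (i′ , j′) adj =
    trans (cong₂ _+_ (∣-∣-comm (toℕ i′) (toℕ i)) (∣-∣-comm (toℕ j′) (toℕ j))) adj

  row-adjacent : ∀ {i j j′} → toℕ j′ ≡ suc (toℕ j) → GridAdj a n (i , j) (i , j′)
  row-adjacent {i} {j} eq =
    cong₂ _+_ (∣n-n∣≡0 (toℕ i)) (trans (cong (∣ toℕ j -_∣) eq) (∣n-1+n∣≡1 (toℕ j)))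

  column-adjacent : ∀ {i i′ j} → toℕ i′ ≡ suc (toℕ i) → GridAdj a n (i , j) (i′ , j)
  column-adjacent {i} {j = j} eq =
    cong₂ _+_ (trans (cong (∣ toℕ i -_∣) eq) (∣n-1+n∣≡1 (toℕ i))) (∣n-n∣≡0 (toℕ j))

  InColumns : ℕ → ℕ → GridV a n → Set
  InColumns lo hi (_ , j) = lo ≤ toℕ j × toℕ j < hi

  columns-connected : (P : GridV a n → Set) {lo hi : ℕ} → hi ≤ a →
    (∀ x y → InColumns lo hi x → InColumns lo hi y → GridAdj a n x y → P x → P y) →
    ∀ {u x} → InColumns lo hi u → InColumns lo hi x → P u → P x
  columns-connected P {lo} {hi} hi≤a close {i₀ , c} {i , j} (lo≤c , c<hi) j∈@(lo≤j , j<hi) =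
    along-column ∘ along-row
    where
    along-row : P (i₀ , c) → P (i₀ , j)
    along-row = Fin-interval-connected (λ j → P (i₀ , j)) hi≤a row-step lo≤c c<hi lo≤j j<hi
      where
      row-step : ∀ {k k′} → lo ≤ toℕ k → toℕ k′ < hi → toℕ k′ ≡ suc (toℕ k) →
                 P (i₀ , k) ⇔ P (i₀ , k′)
      row-step {k} {k′} lo≤k k′<hi eq =
        mk⇔ (close (i₀ , k) (i₀ , k′) k∈ k′∈ adjacent)
            (close (i₀ , k′) (i₀ , k) k′∈ k∈ (GridAdj-sym (i₀ , k) (i₀ , k′) adjacent))
        where
        k∈ : InColumns lo hi (i₀ , k)
        k∈ = lo≤k , <-trans (n<1+n _) (subst (_< hi) eq k′<hi)
        k′∈ : InColumns lo hi (i₀ , k′)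
        k′∈ = subst (lo ≤_) (sym eq) (m≤n⇒m≤1+n lo≤k) , k′<hi
        adjacent : GridAdj a n (i₀ , k) (i₀ , k′)
        adjacent = row-adjacent {i = i₀} eq

    along-column : P (i₀ , j) → P (i , j)
    along-column = Fin-interval-connected (λ i → P (i , j)) ≤-refl column-step
      z≤n (toℕ<n i₀) z≤n (toℕ<n i)
      where
      column-step : ∀ {k k′} → 0 ≤ toℕ k → toℕ k′ < n → toℕ k′ ≡ suc (toℕ k) →
                    P (k , j) ⇔ P (k′ , j)
      column-step {k} {k′} _ _ eq =
        mk⇔ (close (k , j) (k′ , j) j∈ j∈ adjacent)
            (close (k′ , j) (k , j) j∈ j∈ (GridAdj-sym (k , j) (k′ , j) adjacent))
        where
        adjacent : GridAdj a n (k , j) (k′ , j)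
        adjacent = column-adjacent {j = j} eq

module GridDecomposition {a n : ℕ} (T : TreedepthDecomposition (GridAdj a n)) where
  open Decomposition T

  Lowest : ℕ → ℕ → GridV a n → Set
  Lowest lo hi u = InColumns lo hi u × (∀ x → InColumns lo hi x → depth u ≤ depth x)

  depth-attained? : ∀ lo hi →
    Decidable (λ m → ∃ λ i → ∃ λ j → InColumns lo hi (i , j) × depth (i , j) ≡ m)
  depth-attained? lo hi m =
    any? λ i → any? λ j → ((lo ≤? toℕ j) ×-dec (toℕ j <? hi)) ×-dec (depth (i , j) ≟ m)

  lowest-exists : ∀ {lo hi} x₀ → InColumns lo hi x₀ → ∃ (Lowest lo hi)
  lowest-exists {lo} {hi} (i₀ , j₀) x₀∈
    with least-witness (depth-attained? lo hi) (i₀ , j₀ , x₀∈ , refl)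
  ... | _ , (i , j , u∈ , refl) , none-below =
    (i , j) , u∈ , λ (i′ , j′) x∈ → ≮⇒≥ λ dx<du → none-below dx<du (i′ , j′ , x∈ , refl)

  lowest-⊑ : ∀ {lo hi u} → hi ≤ a → Lowest lo hi u → ∀ {x} → InColumns lo hi x → u ⊑ x
  lowest-⊑ {u = u} hi≤a (u∈ , u-lowest) x∈ =
    columns-connected (u ⊑_) hi≤a
      (λ x y _ y∈ adj → ⊑-extend (edge-anc x y adj) (u-lowest y y∈)) u∈ x∈ (inj₁ refl)

  lowest-below-other-columns : ∀ {lo hi u x} → hi ≤ a → Lowest lo hi u → InColumns lo hi x →
                               toℕ (proj₂ x) ≢ toℕ (proj₂ u) → depth u < depth x
  lowest-below-other-columns {x = x} hi≤a lowest x∈ other with lowest-⊑ hi≤a lowest {x} x∈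
  ... | inj₁ refl = ⊥-elim (other refl)
  ... | inj₂ u<x  = Anc⇒depth< u<x

  module _ (d : ℕ) (hit : (j : Fin a) → ∃ λ i → depth (i , j) ≤ d) where

    hit-in-columns : ∀ {lo hi} → lo < hi → hi ≤ a → ∃ λ x → InColumns lo hi x × depth x ≤ d
    hit-in-columns {lo} lo<hi hi≤a =
      let j = fromℕ< (<-≤-trans lo<hi hi≤a)
          lo≡j = sym (toℕ-fromℕ< (<-≤-trans lo<hi hi≤a))
          (i , dx≤d) = hit j
      in (i , j) , (≤-reflexive lo≡j , subst (_< _) lo≡j lo<hi) , dx≤d

    -- lo + 2 ^ suc k ≤ suc hi says the band lo ≤ j < hi has width at least 2^(k+1) − 1.
    columns-depth-bound : ∀ k {lo hi m} → lo + 2 ^ suc k ≤ suc hi → hi ≤ a →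
                          (∀ x → InColumns lo hi x → m < depth x) → suc k + m ≤ d
    columns-depth-bound k {lo} {hi} {m} size hi≤a deep
      with hit-in-columns (columns-nonempty k {lo} size) hi≤a
    columns-depth-bound zero    size hi≤a deep | x , x∈ , dx≤d = <-≤-trans (deep x x∈) dx≤d
    columns-depth-bound (suc k) {lo} {hi} {m} size hi≤a deep | x , x∈ , _
      with lowest-exists x x∈
    ... | u@(_ , c) , lowest@(u∈@(lo≤c , c<hi) , _) =
      ≤-trans (≤-reflexive (sym (+-suc (suc k) m)))
              (≤-trans (+-monoʳ-≤ (suc k) (deep u u∈)) beyond-u)
      where
      beyond-u : suc k + depth u ≤ d
      beyond-u with column-split {lo} {hi} {toℕ c} (2 ^ suc k) size
      ... | inj₁ left  = columns-depth-bound k {lo} left (<⇒≤ (toℕ<n c)) λ _ (lo≤j , j<c) →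
        lowest-below-other-columns hi≤a lowest (lo≤j , <-trans j<c c<hi) (<⇒≢ j<c)
      ... | inj₂ right = columns-depth-bound k {suc (toℕ c)} right hi≤a λ _ (c<j , j<hi) →
        lowest-below-other-columns hi≤a lowest (≤-trans lo≤c (<⇒≤ c<j) , j<hi) (≢-sym (<⇒≢ c<j))

lemma4 : (k n : ℕ) → 1 ≤ k → 1 ≤ n →
    (T : TreedepthDecomposition (GridAdj (2 ^ k ∸ 1) n)) →
    (d : ℕ) → 1 ≤ d →
    ((j : Fin (2 ^ k ∸ 1)) → ∃ λ (i : Fin n) →
        TreedepthDecomposition.depth T (i , j) ≤ d) →
    k ≤ d
-- The hypotheses 1 ≤ n and 1 ≤ d are implied by hit.
lemma4 (suc k) n _ _ T d _ hit =
  subst (_≤ d) (+-identityʳ (suc k))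
    (columns-depth-bound d hit k {0} (m≤n+m∸n (2 ^ suc k) 1) ≤-refl λ x _ → depth-positive x)
  where
  open Decomposition T using (depth-positive)
  open GridDecomposition T using (columns-depth-bound)
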